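{- Let \(\mathbb{E}\) be the set of positive even integers and \(N\subseteq\mathbb{E}\). Then the following subsets of \(W\) belong to the universe \(D_N\) of \(\mathbf{D}_N\): \(\{a\}\), \(\{b_1\}\), \(\{b_3\}\), \(\{c_1\}\), \(\{d\}\), \(\{\ell_i\}\) for every \(i\geqslant 0\), \(\{u_j\}\) for every \(j\geqslant 1\), \(\{b_2\}\cup L\), and \(\{c_2\}\cup U\), where \(L=\{\ell_i\mid i\geqslant 0\}\) and \(U=\{u_j\mid j\geqslant 1\}\).
   Context: The complex algebra \(\mathsf{Cm}(\langle W;R\rangle)\) is the power set Boolean algebra of \(W\) with \(\Diamond X=\{w\in W\mid w\,R\,x\text{ for some }x\in X\}\). The frame \(\mathbb{F}_N=\langle W;R_N\rangle\): \(W\) consists of pairwise distinct elements \(a,b_1,b_2,b_3,c_1,c_2,d\), \(u_i\) (\(i\geqslant 1\)) and \(\ell_i\) (\(i\geqslant 0\)); \(R_N\) is the reflexive symmetric relation on \(W\) whose non-loop edges \(\{x,y\}\) are exactly: \(\{a,b_i\}\) for \(i\in\{1,2,3\}\); \(\{b_i,c_i\}\) for \(i\in\{1,2\}\); \(\{c_1,d\}\); \(\{\ell_0,\ell_1\}\); \(\{a,\ell_i\}\) for all \(i\geqslant 0\); \(\{\ell_i,u_i\}\) for all \(i\geqslant 1\); \(\{\ell_i,u_{i-1}\}\) for \(i\in\mathbb{E}\); \(\{\ell_i,u_{i+1}\}\) for \(i\in N\); \(\{\ell_{i+1},u_i\}\) for \(i\in\mathbb{E}\setminus N\). \(\mathbf{D}_N\)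 is the subalgebra of \(\mathsf{Cm}(\mathbb{F}_N)\) generated by \(\{d\}\), with universe \(D_N\). -}

module Defs where

open import Data.Nat using (ℕ; zero; suc; _≤_)
open import Data.Nat.Divisibility using (_∣_)
open import Data.Bool using (Bool; T; not)
open import Data.Product using (Σ; _×_; ∃; _,_)
open import Data.Sum using (_⊎_)
open import Data.Empty using (⊥)
open import Data.Unit using (⊤)
open import Relation.Binary.PropositionalEquality using (_≡_)
open import Relation.Nullary using (¬_)
open import Function.Bundles using (_⇔_)
open import Level using (Level; 0ℓ)
  renaming (suc to lsuc)

IsE : ℕ → Set
IsE i = (2 ∣ i) × (1 ≤ i)

-- The carrier W.  u j exists only for j ≥ 1 (irrelevant proof argument,
-- so u j p and u j q are definitionally equal).
data W : Set where
  a b₁ b₂ b₃ c₁ c₂ d : W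
  ℓ : ℕ → W
  u : (j : ℕ) → .(1 ≤ j) → W

-- A subset N ⊆ ℕ is given by its characteristic function N : ℕ → Bool.
-- Non-loop edges of F_N, listed in one orientation.
data Edge (N : ℕ → Bool) : W → W → Set where
  a-b₁  : Edge N a b₁
  a-b₂  : Edge N a b₂
  a-b₃  : Edge N a b₃
  b₁-c₁ : Edge N b₁ c₁
  b₂-c₂ : Edge N b₂ c₂
  c₁-d  : Edge N c₁ d
  ℓ₀-ℓ₁ : Edge N (ℓ 0) (ℓ 1)
  a-ℓ   : (i : ℕ) → Edge N a (ℓ i)
  ℓᵢ-uᵢ : (i : ℕ) .(p : 1 ≤ i) → Edge N (ℓ i) (u i p)
  ℓᵢ-uᵢ₋₁ : (i j : ℕ) .(p : 1 ≤ j) → IsE i → suc j ≡ i → Edge N (ℓ i) (u j p)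
  ℓᵢ-uᵢ₊₁ : (i j : ℕ) .(p : 1 ≤ j) → T (N i) → j ≡ suc i → Edge N (ℓ i) (u j p)
  ℓᵢ₊₁-uᵢ : (i : ℕ) .(p : 1 ≤ i) → IsE i → T (not (N i)) → Edge N (ℓ (suc i)) (u i p)

R : (N : ℕ → Bool) → W → W → Set
R N x y = (x ≡ y) ⊎ (Edge N x y ⊎ Edge N y x)

Subset : Set₁
Subset = W → Set

_∪_ : Subset → Subset → Subset
(X ∪ Y) w = X w ⊎ Y w

_∩_ : Subset → Subset → Subset
(X ∩ Y) w = X w × Y w

∁ : Subset → Subset
∁ X w = ¬ X w

∅ : Subset
∅ _ = ⊥

Full : Subset
Full _ = ⊤

⟦_⟧ : W → Subset
⟦ x ⟧ w = w ≡ x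

◇ : (N : ℕ → Bool) → Subset → Subset
◇ N X w = ∃ λ x → R N w x × X x

L : Subset
L w = ∃ λ i → w ≡ ℓ i

U : Subset
U w = ∃ λ j → Σ (1 ≤ j) λ p → w ≡ u j p

-- D N X : X belongs to the universe D_N of the subalgebra of Cm(F_N)
-- generated by {d}, i.e. the least family of subsets containing {d} and closed
-- under the Boolean operations and ◇ (subsets identified extensionally).
data D (N : ℕ → Bool) : Subset → Set₁ where
  gen   : D N ⟦ d ⟧
  empty : D N ∅
  full  : D N Full
  compl : ∀ {X} → D N X → D N (∁ X)
  union : ∀ {X Y} → D N X → D N Y → D N (X ∪ Y)
  inter : ∀ {X Y} → D N X → D N Y → D N (X ∩ Y)
  dia   : ∀ {X} → D N X → D N (◇ N X)
  ext   : ∀ {X Y} → D N X → (∀ w → X w ⇔ Y w) → D N Y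

-- Each point of the statement is singled out as the only neighbour of an already obtained
-- point outside an already obtained set.  From {d} this walks back along d – c₁ – b₁ – a.
-- The points not adjacent to a are c₁, c₂, d and U; distance to them separates b₃, ℓ₀ and
-- the rest of ◇{a}.  The ladder ℓ₀, ℓ₁, u₁, ℓ₂, u₂, … is then climbed two rungs at a time,
-- the local shape of the ladder at an even index e depending on whether e ∈ N.
module Submission where

open import Defs
open import Data.Nat using (ℕ; _≤_; zero; suc; z<s)
open import Data.Nat.Divisibility using (_∣_; _∤_; divides)
open import Data.Nat.Properties using (suc-injective)
open import Data.Bool using (Bool; T; true; false; not)
open import Data.Product using (_×_; _,_; proj₁; proj₂; ∃)
open import Data.Sum using (_⊎_; inj₁; inj₂; fromInj₁; map₁)
open import Data.Empty using (⊥-elim)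
open import Function using (_∘_; case_of_)
open import Function.Bundles using (mk⇔)
open import Relation.Binary.PropositionalEquality using (_≡_; _≢_; refl; cong)
open import Relation.Nullary using (¬_)

double : ℕ → ℕ
double zero    = zero
double (suc m) = suc (suc (double m))

2∣double : ∀ m → 2 ∣ double m
2∣double zero = divides 0 refl
2∣double (suc m) with 2∣double m
... | divides q eq = divides (suc q) (cong (suc ∘ suc) eq)

2∤1+double : ∀ m → 2 ∤ suc (double m)
2∤1+double zero    (divides zero ())
2∤1+double zero    (divides (suc q) ())
2∤1+double (suc m) (divides zero ())
2∤1+double (suc m) (divides (suc q) eq) =
  2∤1+double m (divides q (suc-injective (suc-injective eq)))

even-or-odd : ∀ n → ∃ λ m → n ≡ double m ⊎ n ≡ suc (double m)
even-or-odd zero = zero , inj₁ refl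
even-or-odd (suc n) with even-or-odd n
... | m , inj₁ refl = m , inj₂ refl
... | m , inj₂ refl = suc m , inj₁ refl

IsE-even : ∀ m → IsE (suc (suc (double m)))
IsE-even m = 2∣double (suc m) , z<s

¬IsE-odd : ∀ m → ¬ IsE (suc (double m))
¬IsE-odd m = 2∤1+double m ∘ proj₁

T-or-T-not : ∀ b → T b ⊎ T (not b)
T-or-T-not true  = inj₁ _
T-or-T-not false = inj₂ _

T-not⇒¬T : ∀ {b} → T (not b) → ¬ T b
T-not⇒¬T {true}  ()
T-not⇒¬T {false} _ ()

module _ {N : ℕ → Bool} where

  R-refl : ∀ {x} → R N x x
  R-refl = inj₁ refl

  R-sym : ∀ {x y} → R N x y → R N y x
  R-sym (inj₁ refl)     = inj₁ refl
  R-sym (inj₂ (inj₁ e)) = inj₂ (inj₂ e)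
  R-sym (inj₂ (inj₂ e)) = inj₂ (inj₁ e)

  R-edge : ∀ {x y} → Edge N x y → R N x y
  R-edge = inj₂ ∘ inj₁

  R-edge˘ : ∀ {x y} → Edge N y x → R N x y
  R-edge˘ = inj₂ ∘ inj₂

  ⊆◇ : ∀ {X w} → X w → ◇ N X w
  ⊆◇ Xw = _ , R-refl , Xw

  D-difference : ∀ {S K T : Subset} → D N S → D N K →
    (∀ {w} → T w → S w × ¬ K w) → (∀ {w} → S w → T w ⊎ K w) → D N T
  D-difference DS DK T⊆S∖K S⊆T∪K = ext (inter DS (compl DK)) λ _ →
    mk⇔ (λ (Sw , w∉K) → fromInj₁ (⊥-elim ∘ w∉K) (S⊆T∪K Sw)) T⊆S∖K

  D-sole-neighbour : ∀ {K x y} → D N ⟦ y ⟧ → D N K → R N x y → ¬ K x →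
    (∀ {w} → R N w y → w ≡ x ⊎ K w) → D N ⟦ x ⟧
  D-sole-neighbour Dy DK xRy x∉K nbrs =
    D-difference (dia Dy) DK (λ { refl → (_ , xRy , refl) , x∉K })
                             (λ { (_ , wRy , refl) → nbrs wRy })

  u-R-u : ∀ {i j} .{p : 1 ≤ i} .{q : 1 ≤ j} → R N (u i p) (u j q) → i ≡ j
  u-R-u (inj₁ refl)      = refl
  u-R-u (inj₂ (inj₁ ()))
  u-R-u (inj₂ (inj₂ ()))

  ℓ-suc-R-ℓ-suc : ∀ {i j} → R N (ℓ (suc i)) (ℓ (suc j)) → i ≡ j
  ℓ-suc-R-ℓ-suc (inj₁ refl)      = refl
  ℓ-suc-R-ℓ-suc (inj₂ (inj₁ ()))
  ℓ-suc-R-ℓ-suc (inj₂ (inj₂ ()))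

module Frame (N : ℕ → Bool) (N⊆𝔼 : ∀ i → T (N i) → IsE i) where

  nbr-d : ∀ {w} → R N w d → w ≡ c₁ ⊎ w ≡ d
  nbr-d (inj₁ refl)        = inj₂ refl
  nbr-d (inj₂ (inj₁ c₁-d)) = inj₁ refl
  nbr-d (inj₂ (inj₂ ()))

  nbr-c₁ : ∀ {w} → R N w c₁ → w ≡ b₁ ⊎ w ≡ c₁ ⊎ w ≡ d
  nbr-c₁ (inj₁ refl)         = inj₂ (inj₁ refl)
  nbr-c₁ (inj₂ (inj₁ b₁-c₁)) = inj₁ refl
  nbr-c₁ (inj₂ (inj₂ c₁-d))  = inj₂ (inj₂ refl)

  nbr-b₁ : ∀ {w} → R N w b₁ → w ≡ a ⊎ w ≡ b₁ ⊎ w ≡ c₁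
  nbr-b₁ (inj₁ refl)         = inj₂ (inj₁ refl)
  nbr-b₁ (inj₂ (inj₁ a-b₁))  = inj₁ refl
  nbr-b₁ (inj₂ (inj₂ b₁-c₁)) = inj₂ (inj₂ refl)

  nbr-b₃ : ∀ {w} → R N w b₃ → w ≡ a ⊎ w ≡ b₃
  nbr-b₃ (inj₁ refl)        = inj₂ refl
  nbr-b₃ (inj₂ (inj₁ a-b₃)) = inj₁ refl
  nbr-b₃ (inj₂ (inj₂ ()))

  nbr-a : ∀ {w} → R N w a → w ≡ a ⊎ w ≡ b₁ ⊎ w ≡ b₂ ⊎ w ≡ b₃ ⊎ L w
  nbr-a (inj₁ refl)             = inj₁ refl
  nbr-a (inj₂ (inj₁ ()))
  nbr-a (inj₂ (inj₂ a-b₁))      = inj₂ (inj₁ refl)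
  nbr-a (inj₂ (inj₂ a-b₂))      = inj₂ (inj₂ (inj₁ refl))
  nbr-a (inj₂ (inj₂ a-b₃))      = inj₂ (inj₂ (inj₂ (inj₁ refl)))
  nbr-a (inj₂ (inj₂ (a-ℓ i)))   = inj₂ (inj₂ (inj₂ (inj₂ (i , refl))))

  nbr-ℓ₀ : ∀ {w} → R N w (ℓ 0) → w ≡ ℓ 1 ⊎ w ≡ ℓ 0 ⊎ w ≡ a
  nbr-ℓ₀ (inj₁ refl)                     = inj₂ (inj₁ refl)
  nbr-ℓ₀ (inj₂ (inj₁ (a-ℓ _)))           = inj₂ (inj₂ refl)
  nbr-ℓ₀ (inj₂ (inj₂ ℓ₀-ℓ₁))             = inj₁ refl
  nbr-ℓ₀ (inj₂ (inj₂ (ℓᵢ-uᵢ₋₁ _ _ _ (_ , ()) _)))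
  nbr-ℓ₀ (inj₂ (inj₂ (ℓᵢ-uᵢ₊₁ _ _ _ 0∈N _))) with N⊆𝔼 0 0∈N
  ... | _ , ()

  a∈◇a : ◇ N ⟦ a ⟧ a
  a∈◇a = ⊆◇ refl

  ℓ∈◇a : ∀ i → ◇ N ⟦ a ⟧ (ℓ i)
  ℓ∈◇a i = _ , R-edge˘ (a-ℓ i) , refl

  c₁∉◇a : ¬ ◇ N ⟦ a ⟧ c₁
  c₁∉◇a (_ , inj₂ (inj₁ ()) , refl)
  c₁∉◇a (_ , inj₂ (inj₂ ()) , refl)

  c₂∉◇a : ¬ ◇ N ⟦ a ⟧ c₂
  c₂∉◇a (_ , inj₂ (inj₁ ()) , refl)
  c₂∉◇a (_ , inj₂ (inj₂ ()) , refl)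

  u∉◇a : ∀ {j} .{p : 1 ≤ j} → ¬ ◇ N ⟦ a ⟧ (u j p)
  u∉◇a (_ , inj₂ (inj₁ ()) , refl)
  u∉◇a (_ , inj₂ (inj₂ ()) , refl)

  nbr-ℓ₁ : ∀ {w} → R N w (ℓ 1) → w ≡ u 1 z<s ⊎ ◇ N ⟦ a ⟧ w
  nbr-ℓ₁ (inj₁ refl)                   = inj₂ (ℓ∈◇a 1)
  nbr-ℓ₁ (inj₂ (inj₁ ℓ₀-ℓ₁))           = inj₂ (ℓ∈◇a 0)
  nbr-ℓ₁ (inj₂ (inj₁ (a-ℓ _)))         = inj₂ a∈◇a
  nbr-ℓ₁ (inj₂ (inj₂ (ℓᵢ-uᵢ _ _)))     = inj₁ refl
  nbr-ℓ₁ (inj₂ (inj₂ (ℓᵢ-uᵢ₋₁ _ _ _ 1∈𝔼 _))) = ⊥-elim (¬IsE-odd 0 1∈𝔼)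
  nbr-ℓ₁ (inj₂ (inj₂ (ℓᵢ-uᵢ₊₁ _ _ _ 1∈N _))) = ⊥-elim (¬IsE-odd 0 (N⊆𝔼 1 1∈N))
  nbr-ℓ₁ (inj₂ (inj₂ (ℓᵢ₊₁-uᵢ _ _ (_ , ()) _)))

  D-c₁ : D N ⟦ c₁ ⟧
  D-c₁ = D-sole-neighbour gen gen (R-edge c₁-d) (λ ()) nbr-d

  D-b₁ : D N ⟦ b₁ ⟧
  D-b₁ = D-sole-neighbour D-c₁ (union D-c₁ gen) (R-edge b₁-c₁)
           (λ { (inj₁ ()) ; (inj₂ ()) }) nbr-c₁

  D-a : D N ⟦ a ⟧
  D-a = D-sole-neighbour D-b₁ (union D-b₁ D-c₁) (R-edge a-b₁)
          (λ { (inj₁ ()) ; (inj₂ ()) }) nbr-b₁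

  ◇∁◇a : Subset
  ◇∁◇a = ◇ N (∁ (◇ N ⟦ a ⟧))

  D-◇∁◇a : D N ◇∁◇a
  D-◇∁◇a = dia (compl (dia D-a))

  b₁∈◇∁◇a : ◇∁◇a b₁
  b₁∈◇∁◇a = c₁ , R-edge b₁-c₁ , c₁∉◇a

  b₂∈◇∁◇a : ◇∁◇a b₂
  b₂∈◇∁◇a = c₂ , R-edge b₂-c₂ , c₂∉◇a

  ℓ-suc∈◇∁◇a : ∀ i → ◇∁◇a (ℓ (suc i))
  ℓ-suc∈◇∁◇a i = u (suc i) z<s , R-edge (ℓᵢ-uᵢ (suc i) z<s) , u∉◇a

  b₃-R-R⇒◇a : ∀ {x y} → R N b₃ x → R N x y → ◇ N ⟦ a ⟧ y
  b₃-R-R⇒◇a b₃Rx xRy with nbr-b₃ (R-sym b₃Rx)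
  ... | inj₁ refl = _ , R-sym xRy , refl
  ... | inj₂ refl with nbr-b₃ (R-sym xRy)
  ...   | inj₁ refl = a∈◇a
  ...   | inj₂ refl = _ , R-edge˘ a-b₃ , refl

  -- b₃ is the only neighbour of a at distance at least 3 from every point not adjacent to a.
  D-b₃ : D N ⟦ b₃ ⟧
  D-b₃ = D-sole-neighbour D-a (union D-a (dia D-◇∁◇a)) (R-edge˘ a-b₃) b₃∉K nbrs
    where
    b₃∉K : ¬ (⟦ a ⟧ ∪ ◇ N ◇∁◇a) b₃
    b₃∉K (inj₁ ())
    b₃∉K (inj₂ (_ , b₃Rx , _ , xRy , y∉◇a)) = y∉◇a (b₃-R-R⇒◇a b₃Rx xRy)
    nbrs : ∀ {w} → R N w a → w ≡ b₃ ⊎ (⟦ a ⟧ ∪ ◇ N ◇∁◇a) w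
    nbrs r with nbr-a r
    ... | inj₁ refl                           = inj₂ (inj₁ refl)
    ... | inj₂ (inj₁ refl)                    = inj₂ (inj₂ (⊆◇ b₁∈◇∁◇a))
    ... | inj₂ (inj₂ (inj₁ refl))             = inj₂ (inj₂ (⊆◇ b₂∈◇∁◇a))
    ... | inj₂ (inj₂ (inj₂ (inj₁ refl)))      = inj₁ refl
    ... | inj₂ (inj₂ (inj₂ (inj₂ (zero , refl)))) =
      inj₂ (inj₂ (ℓ 1 , R-edge ℓ₀-ℓ₁ , ℓ-suc∈◇∁◇a 0))
    ... | inj₂ (inj₂ (inj₂ (inj₂ (suc i , refl)))) = inj₂ (inj₂ (⊆◇ (ℓ-suc∈◇∁◇a i)))

  D-ℓ₀ : D N ⟦ ℓ 0 ⟧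
  D-ℓ₀ = D-sole-neighbour D-a (union (union D-a D-b₃) D-◇∁◇a) (R-edge˘ (a-ℓ 0))
           ℓ₀∉K nbrs
    where
    ℓ₀∉K : ¬ ((⟦ a ⟧ ∪ ⟦ b₃ ⟧) ∪ ◇∁◇a) (ℓ 0)
    ℓ₀∉K (inj₁ (inj₁ ()))
    ℓ₀∉K (inj₁ (inj₂ ()))
    ℓ₀∉K (inj₂ (_ , ℓ₀Ry , y∉◇a)) with nbr-ℓ₀ (R-sym ℓ₀Ry)
    ... | inj₁ refl        = y∉◇a (ℓ∈◇a 1)
    ... | inj₂ (inj₁ refl) = y∉◇a (ℓ∈◇a 0)
    ... | inj₂ (inj₂ refl) = y∉◇a a∈◇a
    nbrs : ∀ {w} → R N w a → w ≡ ℓ 0 ⊎ ((⟦ a ⟧ ∪ ⟦ b₃ ⟧) ∪ ◇∁◇a) w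
    nbrs r with nbr-a r
    ... | inj₁ refl                               = inj₂ (inj₁ (inj₁ refl))
    ... | inj₂ (inj₁ refl)                        = inj₂ (inj₂ b₁∈◇∁◇a)
    ... | inj₂ (inj₂ (inj₁ refl))                 = inj₂ (inj₂ b₂∈◇∁◇a)
    ... | inj₂ (inj₂ (inj₂ (inj₁ refl)))          = inj₂ (inj₁ (inj₂ refl))
    ... | inj₂ (inj₂ (inj₂ (inj₂ (zero , refl)))) = inj₁ refl
    ... | inj₂ (inj₂ (inj₂ (inj₂ (suc i , refl)))) = inj₂ (inj₂ (ℓ-suc∈◇∁◇a i))

  D-b₂∪L : D N (⟦ b₂ ⟧ ∪ L)
  D-b₂∪L = D-difference (dia D-a) (union (union D-a D-b₁) D-b₃) sound complete
    where
    K = (⟦ a ⟧ ∪ ⟦ b₁ ⟧) ∪ ⟦ b₃ ⟧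
    sound : ∀ {w} → (⟦ b₂ ⟧ ∪ L) w → ◇ N ⟦ a ⟧ w × ¬ K w
    sound (inj₁ refl)       = (_ , R-edge˘ a-b₂ , refl) ,
                              λ { (inj₁ (inj₁ ())) ; (inj₁ (inj₂ ())) ; (inj₂ ()) }
    sound (inj₂ (i , refl)) = ℓ∈◇a i , λ { (inj₁ (inj₁ ())) ; (inj₁ (inj₂ ())) ; (inj₂ ()) }
    complete : ∀ {w} → ◇ N ⟦ a ⟧ w → (⟦ b₂ ⟧ ∪ L) w ⊎ K w
    complete (_ , r , refl) with nbr-a r
    ... | inj₁ refl                      = inj₂ (inj₁ (inj₁ refl))
    ... | inj₂ (inj₁ refl)               = inj₂ (inj₁ (inj₂ refl))
    ... | inj₂ (inj₂ (inj₁ refl))        = inj₁ (inj₁ refl)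
    ... | inj₂ (inj₂ (inj₂ (inj₁ refl))) = inj₂ (inj₂ refl)
    ... | inj₂ (inj₂ (inj₂ (inj₂ Lw)))   = inj₁ (inj₂ Lw)

  D-c₂∪U : D N (⟦ c₂ ⟧ ∪ U)
  D-c₂∪U = D-difference (compl (dia D-a)) (union D-c₁ gen) sound (complete _)
    where
    sound : ∀ {w} → (⟦ c₂ ⟧ ∪ U) w → ¬ ◇ N ⟦ a ⟧ w × ¬ (⟦ c₁ ⟧ ∪ ⟦ d ⟧) w
    sound (inj₁ refl)          = c₂∉◇a , λ { (inj₁ ()) ; (inj₂ ()) }
    sound (inj₂ (_ , _ , refl)) = u∉◇a , λ { (inj₁ ()) ; (inj₂ ()) }
    complete : ∀ w → ¬ ◇ N ⟦ a ⟧ w → (⟦ c₂ ⟧ ∪ U) w ⊎ (⟦ c₁ ⟧ ∪ ⟦ d ⟧) w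
    complete a  w∉◇a = ⊥-elim (w∉◇a a∈◇a)
    complete b₁ w∉◇a = ⊥-elim (w∉◇a (_ , R-edge˘ a-b₁ , refl))
    complete b₂ w∉◇a = ⊥-elim (w∉◇a (_ , R-edge˘ a-b₂ , refl))
    complete b₃ w∉◇a = ⊥-elim (w∉◇a (_ , R-edge˘ a-b₃ , refl))
    complete c₁ _    = inj₂ (inj₁ refl)
    complete c₂ _    = inj₁ (inj₁ refl)
    complete d  _    = inj₂ (inj₂ refl)
    complete (ℓ i) w∉◇a = ⊥-elim (w∉◇a (ℓ∈◇a i))
    complete (u zero ()) _
    complete (u (suc j) _) _ = inj₁ (inj₂ (suc j , z<s , refl))

  D-ℓ₁ : D N ⟦ ℓ 1 ⟧
  D-ℓ₁ = D-sole-neighbour D-ℓ₀ (union D-ℓ₀ D-a) (R-edge˘ ℓ₀-ℓ₁)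
           (λ { (inj₁ ()) ; (inj₂ ()) }) nbr-ℓ₀

  D-u₁ : D N ⟦ u 1 z<s ⟧
  D-u₁ = D-sole-neighbour D-ℓ₁ (dia D-a) (R-edge˘ (ℓᵢ-uᵢ 1 z<s)) u∉◇a nbr-ℓ₁

  nbr-u-odd : ∀ {k w} → ¬ IsE (suc k) → R N w (u (suc k) z<s) →
    w ≡ ℓ (suc (suc k)) ⊎ w ≡ u (suc k) z<s ⊎ w ≡ ℓ (suc k) ⊎ w ≡ ℓ k
  nbr-u-odd _      (inj₁ refl)                           = inj₂ (inj₁ refl)
  nbr-u-odd _      (inj₂ (inj₁ (ℓᵢ-uᵢ _ _)))             = inj₂ (inj₂ (inj₁ refl))
  nbr-u-odd _      (inj₂ (inj₁ (ℓᵢ-uᵢ₋₁ _ _ _ _ refl)))  = inj₁ refl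
  nbr-u-odd _      (inj₂ (inj₁ (ℓᵢ-uᵢ₊₁ _ _ _ _ refl)))  = inj₂ (inj₂ (inj₂ refl))
  nbr-u-odd 1+k∉𝔼 (inj₂ (inj₁ (ℓᵢ₊₁-uᵢ _ _ 1+k∈𝔼 _))) = ⊥-elim (1+k∉𝔼 1+k∈𝔼)
  nbr-u-odd _      (inj₂ (inj₂ ()))

  module Step (k : ℕ) (1+k∉𝔼 : ¬ IsE (suc k)) (2+k∈𝔼 : IsE (suc (suc k)))
              (3+k∉𝔼 : ¬ IsE (suc (suc (suc k))))
              (D-ℓₖ : D N ⟦ ℓ k ⟧) (D-ℓₖ₊₁ : D N ⟦ ℓ (suc k) ⟧)
              (D-uₖ₊₁ : D N ⟦ u (suc k) z<s ⟧) where

    e : ℕ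
    e = suc (suc k)

    nbr-ℓₑ : ∀ {w} → R N w (ℓ e) →
      w ≡ ℓ e ⊎ w ≡ a ⊎ w ≡ u (suc k) z<s ⊎ w ≡ u e z<s ⊎ (T (N e) × w ≡ u (suc e) z<s)
    nbr-ℓₑ (inj₁ refl)                              = inj₁ refl
    nbr-ℓₑ (inj₂ (inj₁ (a-ℓ _)))                    = inj₂ (inj₁ refl)
    nbr-ℓₑ (inj₂ (inj₂ (ℓᵢ-uᵢ₋₁ _ _ _ _ refl)))     = inj₂ (inj₂ (inj₁ refl))
    nbr-ℓₑ (inj₂ (inj₂ (ℓᵢ-uᵢ _ _)))                = inj₂ (inj₂ (inj₂ (inj₁ refl)))
    nbr-ℓₑ (inj₂ (inj₂ (ℓᵢ-uᵢ₊₁ _ _ _ e∈N refl)))   = inj₂ (inj₂ (inj₂ (inj₂ (e∈N , refl))))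
    nbr-ℓₑ (inj₂ (inj₂ (ℓᵢ₊₁-uᵢ _ _ 1+k∈𝔼 _)))      = ⊥-elim (1+k∉𝔼 1+k∈𝔼)

    nbr-uₑ : ∀ {w} → R N w (u e z<s) →
      (T (not (N e)) × w ≡ ℓ (suc e)) ⊎ w ≡ u e z<s ⊎ w ≡ ℓ e
    nbr-uₑ (inj₁ refl)                             = inj₂ (inj₁ refl)
    nbr-uₑ (inj₂ (inj₁ (ℓᵢ-uᵢ _ _)))               = inj₂ (inj₂ refl)
    nbr-uₑ (inj₂ (inj₁ (ℓᵢ-uᵢ₋₁ _ _ _ 3+k∈𝔼 refl))) = ⊥-elim (3+k∉𝔼 3+k∈𝔼)
    nbr-uₑ (inj₂ (inj₁ (ℓᵢ-uᵢ₊₁ _ _ _ 1+k∈N refl))) = ⊥-elim (1+k∉𝔼 (N⊆𝔼 _ 1+k∈N))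
    nbr-uₑ (inj₂ (inj₁ (ℓᵢ₊₁-uᵢ _ _ _ e∉N)))       = inj₁ (e∉N , refl)
    nbr-uₑ (inj₂ (inj₂ ()))

    nbr-ℓₑ₊₁ : ∀ {w} → R N w (ℓ (suc e)) →
      w ≡ u (suc e) z<s ⊎ w ≡ ℓ (suc e) ⊎ w ≡ a ⊎ (T (not (N e)) × w ≡ u e z<s)
    nbr-ℓₑ₊₁ (inj₁ refl)                            = inj₂ (inj₁ refl)
    nbr-ℓₑ₊₁ (inj₂ (inj₁ (a-ℓ _)))                  = inj₂ (inj₂ (inj₁ refl))
    nbr-ℓₑ₊₁ (inj₂ (inj₂ (ℓᵢ-uᵢ _ _)))              = inj₁ refl
    nbr-ℓₑ₊₁ (inj₂ (inj₂ (ℓᵢ-uᵢ₋₁ _ _ _ 3+k∈𝔼 _)))  = ⊥-elim (3+k∉𝔼 3+k∈𝔼)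
    nbr-ℓₑ₊₁ (inj₂ (inj₂ (ℓᵢ-uᵢ₊₁ _ _ _ 3+k∈N _)))  = ⊥-elim (3+k∉𝔼 (N⊆𝔼 _ 3+k∈N))
    nbr-ℓₑ₊₁ (inj₂ (inj₂ (ℓᵢ₊₁-uᵢ _ _ _ e∉N)))      = inj₂ (inj₂ (inj₂ (e∉N , refl)))


    D-ℓₑ : D N ⟦ ℓ e ⟧
    D-ℓₑ = D-sole-neighbour D-uₖ₊₁ (union D-uₖ₊₁ (union D-ℓₖ₊₁ D-ℓₖ))
             (R-edge (ℓᵢ-uᵢ₋₁ e (suc k) z<s 2+k∈𝔼 refl))
             (λ { (inj₁ ()) ; (inj₂ (inj₁ ())) ; (inj₂ (inj₂ ())) }) (nbr-u-odd 1+k∉𝔼)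

    Next : Set₁
    Next = D N ⟦ u e z<s ⟧ × D N ⟦ ℓ (suc e) ⟧ × D N ⟦ u (suc e) z<s ⟧

    next-∉N : T (not (N e)) → Next
    next-∉N e∉N = D-uₑ , D-ℓₑ₊₁ , D-uₑ₊₁
      where
      D-uₑ : D N ⟦ u e z<s ⟧
      D-uₑ = D-sole-neighbour D-ℓₑ (union (dia D-a) D-uₖ₊₁) (R-edge˘ (ℓᵢ-uᵢ e z<s))
               (λ { (inj₁ uₑ∈◇a) → u∉◇a uₑ∈◇a ; (inj₂ ()) }) nbrs
        where
        nbrs : ∀ {w} → R N w (ℓ e) → w ≡ u e z<s ⊎ (◇ N ⟦ a ⟧ ∪ ⟦ u (suc k) z<s ⟧) w
        nbrs r with nbr-ℓₑ r
        ... | inj₁ refl                            = inj₂ (inj₁ (ℓ∈◇a e))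
        ... | inj₂ (inj₁ refl)                     = inj₂ (inj₁ a∈◇a)
        ... | inj₂ (inj₂ (inj₁ refl))              = inj₂ (inj₂ refl)
        ... | inj₂ (inj₂ (inj₂ (inj₁ refl)))       = inj₁ refl
        ... | inj₂ (inj₂ (inj₂ (inj₂ (e∈N , _)))) = ⊥-elim (T-not⇒¬T e∉N e∈N)

      D-ℓₑ₊₁ : D N ⟦ ℓ (suc e) ⟧
      D-ℓₑ₊₁ = D-sole-neighbour D-uₑ (union D-uₑ D-ℓₑ) (R-edge (ℓᵢ₊₁-uᵢ e z<s 2+k∈𝔼 e∉N))
                 (λ { (inj₁ ()) ; (inj₂ ()) }) (map₁ proj₂ ∘ nbr-uₑ)

      D-uₑ₊₁ : D N ⟦ u (suc e) z<s ⟧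
      D-uₑ₊₁ = D-sole-neighbour D-ℓₑ₊₁ (union (dia D-a) D-uₑ) (R-edge˘ (ℓᵢ-uᵢ (suc e) z<s))
                 (λ { (inj₁ uₑ₊₁∈◇a) → u∉◇a uₑ₊₁∈◇a ; (inj₂ ()) }) nbrs
        where
        nbrs : ∀ {w} → R N w (ℓ (suc e)) → w ≡ u (suc e) z<s ⊎ (◇ N ⟦ a ⟧ ∪ ⟦ u e z<s ⟧) w
        nbrs r with nbr-ℓₑ₊₁ r
        ... | inj₁ refl                      = inj₁ refl
        ... | inj₂ (inj₁ refl)               = inj₂ (inj₁ (ℓ∈◇a (suc e)))
        ... | inj₂ (inj₂ (inj₁ refl))        = inj₂ (inj₁ a∈◇a)
        ... | inj₂ (inj₂ (inj₂ (_ , refl))) = inj₂ (inj₂ refl)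

    next-∈N : T (N e) → Next
    next-∈N e∈N = D-uₑ , D-ℓₑ₊₁ , D-uₑ₊₁
      where
      ℓ-odd∉◇ℓₑ : ∀ {i} → i ≢ suc k → ¬ ◇ N ⟦ ℓ e ⟧ (ℓ (suc i))
      ℓ-odd∉◇ℓₑ i≢1+k (_ , r , refl) = i≢1+k (ℓ-suc-R-ℓ-suc r)

      -- Of the neighbours of ℓₑ in U, only uₑ has all its neighbours adjacent to ℓₑ.
      D-uₑ : D N ⟦ u e z<s ⟧
      D-uₑ = D-sole-neighbour D-ℓₑ (union (dia D-a) (dia (compl (dia D-ℓₑ))))
               (R-edge˘ (ℓᵢ-uᵢ e z<s)) uₑ∉K nbrs
        where
        K = ◇ N ⟦ a ⟧ ∪ ◇ N (∁ (◇ N ⟦ ℓ e ⟧))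
        uₑ∉K : ¬ K (u e z<s)
        uₑ∉K (inj₁ uₑ∈◇a) = u∉◇a uₑ∈◇a
        uₑ∉K (inj₂ (_ , uₑRy , y∉◇ℓₑ)) with nbr-uₑ (R-sym uₑRy)
        ... | inj₁ (e∉N , _)   = T-not⇒¬T e∉N e∈N
        ... | inj₂ (inj₁ refl) = y∉◇ℓₑ (_ , R-edge˘ (ℓᵢ-uᵢ e z<s) , refl)
        ... | inj₂ (inj₂ refl) = y∉◇ℓₑ (⊆◇ refl)
        nbrs : ∀ {w} → R N w (ℓ e) → w ≡ u e z<s ⊎ K w
        nbrs r with nbr-ℓₑ r
        ... | inj₁ refl                      = inj₂ (inj₁ (ℓ∈◇a e))
        ... | inj₂ (inj₁ refl)               = inj₂ (inj₁ a∈◇a)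
        ... | inj₂ (inj₂ (inj₁ refl))        =
          inj₂ (inj₂ (ℓ (suc k) , R-edge˘ (ℓᵢ-uᵢ (suc k) z<s) , ℓ-odd∉◇ℓₑ λ ()))
        ... | inj₂ (inj₂ (inj₂ (inj₁ refl))) = inj₁ refl
        ... | inj₂ (inj₂ (inj₂ (inj₂ (_ , refl)))) =
          inj₂ (inj₂ (ℓ (suc e) , R-edge˘ (ℓᵢ-uᵢ (suc e) z<s) , ℓ-odd∉◇ℓₑ λ ()))

      D-uₑ₊₁ : D N ⟦ u (suc e) z<s ⟧
      D-uₑ₊₁ = D-sole-neighbour D-ℓₑ (union (dia D-a) (union D-uₖ₊₁ D-uₑ))
                 (R-edge˘ (ℓᵢ-uᵢ₊₁ e (suc e) z<s e∈N refl))
                 (λ { (inj₁ uₑ₊₁∈◇a) → u∉◇a uₑ₊₁∈◇a ; (inj₂ (inj₁ ())) ; (inj₂ (inj₂ ())) })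
                 nbrs
        where
        nbrs : ∀ {w} → R N w (ℓ e) →
          w ≡ u (suc e) z<s ⊎ (◇ N ⟦ a ⟧ ∪ (⟦ u (suc k) z<s ⟧ ∪ ⟦ u e z<s ⟧)) w
        nbrs r with nbr-ℓₑ r
        ... | inj₁ refl                            = inj₂ (inj₁ (ℓ∈◇a e))
        ... | inj₂ (inj₁ refl)                     = inj₂ (inj₁ a∈◇a)
        ... | inj₂ (inj₂ (inj₁ refl))              = inj₂ (inj₂ (inj₁ refl))
        ... | inj₂ (inj₂ (inj₂ (inj₁ refl)))       = inj₂ (inj₂ (inj₂ refl))
        ... | inj₂ (inj₂ (inj₂ (inj₂ (_ , refl)))) = inj₁ refl

      -- ℓₑ₊₂ is told apart from ℓₑ₊₁ by its neighbour uₑ₊₂, which is neither a nor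
      -- adjacent to uₑ₊₁.
      D-ℓₑ₊₁ : D N ⟦ ℓ (suc e) ⟧
      D-ℓₑ₊₁ = D-sole-neighbour D-uₑ₊₁
                 (union D-uₑ₊₁ (union D-ℓₑ (dia (compl (union D-a (dia D-uₑ₊₁))))))
                 (R-edge (ℓᵢ-uᵢ (suc e) z<s)) ℓₑ₊₁∉K nbrs
        where
        K = ⟦ u (suc e) z<s ⟧ ∪ (⟦ ℓ e ⟧ ∪ ◇ N (∁ (⟦ a ⟧ ∪ ◇ N ⟦ u (suc e) z<s ⟧)))
        ℓₑ₊₁∉K : ¬ K (ℓ (suc e))
        ℓₑ₊₁∉K (inj₁ ())
        ℓₑ₊₁∉K (inj₂ (inj₁ ()))
        ℓₑ₊₁∉K (inj₂ (inj₂ (_ , ℓₑ₊₁Ry , y∉))) with nbr-ℓₑ₊₁ (R-sym ℓₑ₊₁Ry)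
        ... | inj₁ refl                      = y∉ (inj₂ (⊆◇ refl))
        ... | inj₂ (inj₁ refl)               = y∉ (inj₂ (_ , R-edge (ℓᵢ-uᵢ (suc e) z<s) , refl))
        ... | inj₂ (inj₂ (inj₁ refl))        = y∉ (inj₁ refl)
        ... | inj₂ (inj₂ (inj₂ (e∉N , _))) = T-not⇒¬T e∉N e∈N
        nbrs : ∀ {w} → R N w (u (suc e) z<s) → w ≡ ℓ (suc e) ⊎ K w
        nbrs r with nbr-u-odd 3+k∉𝔼 r
        ... | inj₁ refl =
          inj₂ (inj₂ (inj₂ (u (suc (suc e)) z<s , R-edge (ℓᵢ-uᵢ (suc (suc e)) z<s) ,
            λ { (inj₁ ()) ; (inj₂ (_ , uₑ₊₂Ruₑ₊₁ , refl)) → case u-R-u uₑ₊₂Ruₑ₊₁ of λ () })))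
        ... | inj₂ (inj₁ refl)               = inj₂ (inj₁ refl)
        ... | inj₂ (inj₂ (inj₁ refl))        = inj₁ refl
        ... | inj₂ (inj₂ (inj₂ refl))        = inj₂ (inj₂ (inj₁ refl))

    next : Next
    next with T-or-T-not (N e)
    ... | inj₁ e∈N = next-∈N e∈N
    ... | inj₂ e∉N = next-∉N e∉N

  Known : ℕ → Set₁
  Known m = D N ⟦ ℓ (double m) ⟧ × D N ⟦ ℓ (suc (double m)) ⟧ × D N ⟦ u (suc (double m)) z<s ⟧

  step : ∀ m → Known m → D N ⟦ u (suc (suc (double m))) z<s ⟧ × Known (suc m)
  step m (D-ℓₖ , D-ℓₖ₊₁ , D-uₖ₊₁) =
    let D-uₑ , D-ℓₑ₊₁ , D-uₑ₊₁ = next in D-uₑ , D-ℓₑ , D-ℓₑ₊₁ , D-uₑ₊₁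
    where open Step (double m) (¬IsE-odd m) (IsE-even m) (¬IsE-odd (suc m))
                    D-ℓₖ D-ℓₖ₊₁ D-uₖ₊₁

  known : ∀ m → Known m
  known zero    = D-ℓ₀ , D-ℓ₁ , D-u₁
  known (suc m) = proj₂ (step m (known m))

  D-ℓ : ∀ i → D N ⟦ ℓ i ⟧
  D-ℓ i with even-or-odd i
  ... | m , inj₁ refl = proj₁ (known m)
  ... | m , inj₂ refl = proj₁ (proj₂ (known m))

  D-u : ∀ j .(p : 1 ≤ j) → D N ⟦ u j p ⟧
  D-u zero ()
  D-u (suc j) _ with even-or-odd j
  ... | m , inj₁ refl = proj₂ (proj₂ (known m))
  ... | m , inj₂ refl = proj₁ (step m (known m))

lemma3p5 : (N : ℕ → Bool) → (∀ i → T (N i) → IsE i) →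
    D N ⟦ a ⟧ × D N ⟦ b₁ ⟧ × D N ⟦ b₃ ⟧ × D N ⟦ c₁ ⟧ × D N ⟦ d ⟧
      × (∀ i → D N ⟦ ℓ i ⟧)
      × (∀ j → .(p : 1 ≤ j) → D N ⟦ u j p ⟧)
      × D N (⟦ b₂ ⟧ ∪ L) × D N (⟦ c₂ ⟧ ∪ U)
lemma3p5 N N⊆𝔼 = D-a , D-b₁ , D-b₃ , D-c₁ , gen , D-ℓ , D-u , D-b₂∪L , D-c₂∪U
  where open Frame N N⊆𝔼
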